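{- Let $G$ be an $S_{2,2}$-free connected outerplanar graph with $|V(G)|\ge 6$. Suppose a block $B$ of $G$ is adjacent to a block of $G$ that is isomorphic to $M_4$. Then: (1) $B\cong M_2$; (2) $B$ is adjacent to at most two blocks, and if $B$ is adjacent to two blocks, then the block adjacent to $B$ other than the one isomorphic to $M_4$ is isomorphic to $M_2$.
   Context: All graphs are finite, simple and undirected. The double star $S_{2,2}$ is the graph obtained from an edge $xy$ by joining each of $x$ and $y$ to two new vertices. A graph is outerplanar if it has a planar embedding with all vertices on the boundary of the outer face; it is maximal outerplanar if adding any edge between non-adjacent vertices destroys outerplanarity. $M_k$ denotes the maximal outerplanar graph on $k$ vertices (unique for $k\le 5$); in particular $M_2=K_2$ and $M_4$ is $K_4$ minus an edge. A block is a maximal subgraph without a cut vertex; two blocks are adjacent if they share exactly one common vertex. -}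

module Defs where

open import Data.Nat using (ℕ; _≤_)
open import Data.Fin using (Fin; zero; suc; _<_)
open import Data.Bool using (Bool; true; false; not; _∧_; _∨_)
open import Data.Fin.Properties using () renaming (_≟_ to _≟ᶠ_)
open import Relation.Nullary using (¬_)
open import Relation.Nullary.Decidable using (⌊_⌋)
open import Relation.Binary.PropositionalEquality using (_≡_; _≢_)
open import Data.Product using (Σ; ∃; _×_; _,_)
open import Data.Empty using (⊥)
open import Function.Definitions using (Injective)

record Graph : Set where
  field
    n     : ℕ
    adj   : Fin n → Fin n → Bool
    sym   : ∀ u v → adj u v ≡ adj v u
    irrefl : ∀ v → adj v v ≡ false
open Graph public

Edge : (G : Graph) → Fin (n G) → Fin (n G) → Set
Edge G u v = adj G u v ≡ true

VSet : Graph → Set₁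
VSet G = Fin (n G) → Set

Sub : (G : Graph) → VSet G → VSet G → Set
Sub G S T = ∀ v → S v → T v

SameSet : (G : Graph) → VSet G → VSet G → Set
SameSet G S T = Sub G S T × Sub G T S

Delete : (G : Graph) → VSet G → Fin (n G) → VSet G
Delete G S v w = S w × w ≢ v

data Walk (G : Graph) (S : VSet G) : Fin (n G) → Fin (n G) → Set where
  here : ∀ {u} → S u → Walk G S u u
  step : ∀ {u w v} → S u → Edge G u w → Walk G S w v → Walk G S u v

ConnectedOn : (G : Graph) → VSet G → Set
ConnectedOn G S = ∀ u v → S u → S v → Walk G S u v

Connected : Graph → Set
Connected G = ConnectedOn G (λ _ → Data.Unit.⊤)
  where import Data.Unit

Nonseparable : (G : Graph) → VSet G → Set
Nonseparable G S = ConnectedOn G S × (∀ v → S v → ConnectedOn G (Delete G S v))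

-- A block of G: a maximal subgraph without a cut vertex (given by its vertex set;
-- blocks are induced subgraphs).
Block : (G : Graph) → VSet G → Set₁
Block G S = Nonseparable G S × (∀ T → Sub G S T → Nonseparable G T → Sub G T S)

AdjacentBlocks : (G : Graph) → VSet G → VSet G → Set
AdjacentBlocks G B C =
  Σ (Fin (n G)) λ v → (B v × C v) × (∀ w → B w → C w → w ≡ v)

InducedIso : (G : Graph) → VSet G → (H : Graph) → Set
InducedIso G S H =
  Σ (Fin (n H) → Fin (n G)) λ f →
    Injective _≡_ _≡_ f
    × (∀ i → S (f i))
    × (∀ v → S v → ∃ λ i → f i ≡ v)
    × (∀ i j → adj H i j ≡ adj G (f i) (f j))

ContainsSubgraph : (G H : Graph) → Set
ContainsSubgraph G H =
  Σ (Fin (n H) → Fin (n G)) λ f →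
    Injective _≡_ _≡_ f × (∀ i j → Edge H i j → Edge G (f i) (f j))

-- Outerplanar: vertices can be placed on a circle (in the cyclic order given by
-- the bijection σ from positions to vertices) with all edges drawn as pairwise
-- non-crossing chords.
Outerplanar : Graph → Set
Outerplanar G =
  Σ (Fin (n G) → Fin (n G)) λ σ →
    Injective _≡_ _≡_ σ
    × (∀ a b c d → a < c → c < b → b < d →
         Edge G (σ a) (σ b) → Edge G (σ c) (σ d) → ⊥)

neq : ∀ {k} → Fin k → Fin k → Bool
neq i j = not ⌊ i ≟ᶠ j ⌋

M2 : Graph
M2 = record { n = 2 ; adj = neq ; sym = s ; irrefl = r }
  where
  s : ∀ u v → neq u v ≡ neq v u
  s zero zero = Relation.Binary.PropositionalEquality.refl
  s zero (suc zero) = Relation.Binary.PropositionalEquality.refl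
  s (suc zero) zero = Relation.Binary.PropositionalEquality.refl
  s (suc zero) (suc zero) = Relation.Binary.PropositionalEquality.refl
  r : ∀ v → neq v v ≡ false
  r zero = Relation.Binary.PropositionalEquality.refl
  r (suc zero) = Relation.Binary.PropositionalEquality.refl

m4adj : Fin 4 → Fin 4 → Bool
m4adj zero (suc zero) = false
m4adj (suc zero) zero = false
m4adj i j = neq i j

M4 : Graph
M4 = record { n = 4 ; adj = m4adj ; sym = s ; irrefl = r }
  where
  open Relation.Binary.PropositionalEquality using (refl)
  s : ∀ u v → m4adj u v ≡ m4adj v u
  s zero zero = refl
  s zero (suc zero) = refl
  s zero (suc (suc zero)) = refl
  s zero (suc (suc (suc zero))) = refl
  s (suc zero) zero = refl
  s (suc zero) (suc zero) = refl
  s (suc zero) (suc (suc zero)) = refl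
  s (suc zero) (suc (suc (suc zero))) = refl
  s (suc (suc zero)) zero = refl
  s (suc (suc zero)) (suc zero) = refl
  s (suc (suc zero)) (suc (suc zero)) = refl
  s (suc (suc zero)) (suc (suc (suc zero))) = refl
  s (suc (suc (suc zero))) zero = refl
  s (suc (suc (suc zero))) (suc zero) = refl
  s (suc (suc (suc zero))) (suc (suc zero)) = refl
  s (suc (suc (suc zero))) (suc (suc (suc zero))) = refl
  r : ∀ v → m4adj v v ≡ false
  r zero = refl
  r (suc zero) = refl
  r (suc (suc zero)) = refl
  r (suc (suc (suc zero))) = refl

s22adj : Fin 6 → Fin 6 → Bool
s22adj zero (suc zero) = true
s22adj (suc zero) zero = true
s22adj zero (suc (suc zero)) = true
s22adj (suc (suc zero)) zero = true
s22adj zero (suc (suc (suc zero))) = true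
s22adj (suc (suc (suc zero))) zero = true
s22adj (suc zero) (suc (suc (suc (suc zero)))) = true
s22adj (suc (suc (suc (suc zero)))) (suc zero) = true
s22adj (suc zero) (suc (suc (suc (suc (suc zero))))) = true
s22adj (suc (suc (suc (suc (suc zero))))) (suc zero) = true
s22adj _ _ = false

S22 : Graph
S22 = record { n = 6 ; adj = s22adj ; sym = s ; irrefl = r }
  where
  open Relation.Binary.PropositionalEquality using (refl)
  s : ∀ u v → s22adj u v ≡ s22adj v u
  s zero zero = refl
  s zero (suc zero) = refl
  s zero (suc (suc zero)) = refl
  s zero (suc (suc (suc zero))) = refl
  s zero (suc (suc (suc (suc zero)))) = refl
  s zero (suc (suc (suc (suc (suc zero))))) = refl
  s (suc zero) zero = refl
  s (suc zero) (suc zero) = refl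
  s (suc zero) (suc (suc zero)) = refl
  s (suc zero) (suc (suc (suc zero))) = refl
  s (suc zero) (suc (suc (suc (suc zero)))) = refl
  s (suc zero) (suc (suc (suc (suc (suc zero))))) = refl
  s (suc (suc zero)) zero = refl
  s (suc (suc zero)) (suc zero) = refl
  s (suc (suc zero)) (suc (suc zero)) = refl
  s (suc (suc zero)) (suc (suc (suc zero))) = refl
  s (suc (suc zero)) (suc (suc (suc (suc zero)))) = refl
  s (suc (suc zero)) (suc (suc (suc (suc (suc zero))))) = refl
  s (suc (suc (suc zero))) zero = refl
  s (suc (suc (suc zero))) (suc zero) = refl
  s (suc (suc (suc zero))) (suc (suc zero)) = refl
  s (suc (suc (suc zero))) (suc (suc (suc zero))) = refl
  s (suc (suc (suc zero))) (suc (suc (suc (suc zero)))) = refl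
  s (suc (suc (suc zero))) (suc (suc (suc (suc (suc zero))))) = refl
  s (suc (suc (suc (suc zero)))) zero = refl
  s (suc (suc (suc (suc zero)))) (suc zero) = refl
  s (suc (suc (suc (suc zero)))) (suc (suc zero)) = refl
  s (suc (suc (suc (suc zero)))) (suc (suc (suc zero))) = refl
  s (suc (suc (suc (suc zero)))) (suc (suc (suc (suc zero)))) = refl
  s (suc (suc (suc (suc zero)))) (suc (suc (suc (suc (suc zero))))) = refl
  s (suc (suc (suc (suc (suc zero))))) zero = refl
  s (suc (suc (suc (suc (suc zero))))) (suc zero) = refl
  s (suc (suc (suc (suc (suc zero))))) (suc (suc zero)) = refl
  s (suc (suc (suc (suc (suc zero))))) (suc (suc (suc zero))) = refl
  s (suc (suc (suc (suc (suc zero))))) (suc (suc (suc (suc zero)))) = refl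
  s (suc (suc (suc (suc (suc zero))))) (suc (suc (suc (suc (suc zero))))) = refl
  r : ∀ v → s22adj v v ≡ false
  r zero = refl
  r (suc zero) = refl
  r (suc (suc zero)) = refl
  r (suc (suc (suc zero))) = refl
  r (suc (suc (suc (suc zero)))) = refl
  r (suc (suc (suc (suc (suc zero))))) = refl

{-# OPTIONS --safe #-}
module Submission where

-- Let x be the vertex shared by B and the block A ≅ M₄. Every vertex of M₄ has two
-- neighbours in A and a neighbour of degree 3 in A, so if x, or a neighbour y ∉ A of x,
-- had two further neighbours outside A, these would complete a double star S₂,₂.
-- Hence x has a unique neighbour y outside A, B is the edge xy, a block meeting B in x
-- shares an edge with A and so equals A, and a block meeting B in y is the edge from y
-- to its unique neighbour other than x.

open import Defs
open import Data.Nat using (_≤_)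
open import Data.Product using (_×_)
open import Data.Sum using (_⊎_)
open import Relation.Nullary using (¬_)

open import Data.Bool using (true)
open import Data.Bool.Properties using () renaming (_≟_ to _≟ᵇ_)
open import Data.Empty using (⊥-elim)
open import Data.Fin using (Fin; zero; suc)
open import Data.Fin.Properties using (any?) renaming (_≟_ to _≟ᶠ_)
open import Data.Product using (∃; ∃₂; _,_; proj₁; proj₂)
open import Data.Sum using (inj₁; inj₂)
import Data.Sum as Sum
open import Data.Vec using ([]; _∷_; lookup)
open import Data.Vec.Relation.Unary.All using ([]; _∷_)
open import Data.Vec.Relation.Unary.AllPairs using ([]; _∷_)
open import Data.Vec.Relation.Unary.Unique.Propositional using (Unique)
open import Data.Vec.Relation.Unary.Unique.Propositional.Properties using (lookup-injective)
open import Function.Definitions using (Injective)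
open import Relation.Binary.PropositionalEquality as ≡ using (_≡_; _≢_; refl; trans; subst; ≢-sym)
open import Relation.Nullary using (Dec; yes; no)
open import Relation.Nullary.Decidable using (¬?; _×-dec_; decidable-stable)
open import Relation.Unary using (Decidable)

pigeonhole : ∀ {a r p q} {X : Set a} (R : X → X → Set r) {P : X → Set p} {Q : X → Set q} →
  (∀ {c d} → P c → P d → R c d) → (∀ {c d} → Q c → Q d → R c d) →
  ∀ {c₁ c₂ c₃} → P c₁ ⊎ Q c₁ → P c₂ ⊎ Q c₂ → P c₃ ⊎ Q c₃ → R c₁ c₂ ⊎ R c₁ c₃ ⊎ R c₂ c₃
pigeonhole R P⇒R Q⇒R (inj₁ P₁) (inj₁ P₂) _         = inj₁ (P⇒R P₁ P₂)
pigeonhole R P⇒R Q⇒R (inj₂ Q₁) (inj₂ Q₂) _         = inj₁ (Q⇒R Q₁ Q₂)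
pigeonhole R P⇒R Q⇒R (inj₁ P₁) (inj₂ _)  (inj₁ P₃) = inj₂ (inj₁ (P⇒R P₁ P₃))
pigeonhole R P⇒R Q⇒R (inj₂ Q₁) (inj₁ _)  (inj₂ Q₃) = inj₂ (inj₁ (Q⇒R Q₁ Q₃))
pigeonhole R P⇒R Q⇒R (inj₁ _)  (inj₂ Q₂) (inj₂ Q₃) = inj₂ (inj₂ (Q⇒R Q₂ Q₃))
pigeonhole R P⇒R Q⇒R (inj₂ _)  (inj₁ P₂) (inj₁ P₃) = inj₂ (inj₂ (P⇒R P₂ P₃))

M4-minimum-degree-2 : ∀ i → ∃₂ λ k l → k ≢ l × Edge M4 i k × Edge M4 i l
M4-minimum-degree-2 zero                   = suc (suc zero) , suc (suc (suc zero)) , (λ ()) , refl , refl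
M4-minimum-degree-2 (suc zero)             = suc (suc zero) , suc (suc (suc zero)) , (λ ()) , refl , refl
M4-minimum-degree-2 (suc (suc zero))       = zero , suc zero , (λ ()) , refl , refl
M4-minimum-degree-2 (suc (suc (suc zero))) = zero , suc zero , (λ ()) , refl , refl

M4-degree-3-neighbour : ∀ i → ∃ λ j → Edge M4 i j ×
  ∃₂ λ k l → k ≢ l × i ≢ k × i ≢ l × Edge M4 j k × Edge M4 j l
M4-degree-3-neighbour zero =
  suc (suc zero) , refl , suc zero , suc (suc (suc zero)) , (λ ()) , (λ ()) , (λ ()) , refl , refl
M4-degree-3-neighbour (suc zero) =
  suc (suc zero) , refl , zero , suc (suc (suc zero)) , (λ ()) , (λ ()) , (λ ()) , refl , refl
M4-degree-3-neighbour (suc (suc zero)) =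
  suc (suc (suc zero)) , refl , zero , suc zero , (λ ()) , (λ ()) , (λ ()) , refl , refl
M4-degree-3-neighbour (suc (suc (suc zero))) =
  suc (suc zero) , refl , zero , suc zero , (λ ()) , (λ ()) , (λ ()) , refl , refl

module Properties (G : Graph) where

  private
    V : Set
    V = Fin (n G)

    variable
      a b c d e g k l p q u v w x y z : V
      A C D S T : VSet G

  Edge? : ∀ u v → Dec (Edge G u v)
  Edge? u v = adj G u v ≟ᵇ true

  Edge-sym : Edge G u v → Edge G v u
  Edge-sym {u} {v} uv = trans (Graph.sym G v u) uv

  Edge⇒≢ : Edge G u v → u ≢ v
  Edge⇒≢ {u} uv refl with trans (≡.sym uv) (irrefl G u)
  ... | ()

  ∈∉⇒≢ : A u → ¬ A w → u ≢ w
  ∈∉⇒≢ Au w∉A refl = w∉A Au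

  SameSet-sym : SameSet G S T → SameSet G T S
  SameSet-sym (S⊆T , T⊆S) = T⊆S , S⊆T

  SameSet-trans : SameSet G S T → SameSet G T C → SameSet G S C
  SameSet-trans (S⊆T , T⊆S) (T⊆C , C⊆T) = (λ u Su → T⊆C u (S⊆T u Su)) , (λ u Cu → T⊆S u (C⊆T u Cu))

  Delete-mono : Sub G S T → Sub G (Delete G S z) (Delete G T z)
  Delete-mono S⊆T u (Su , u≢z) = S⊆T u Su , u≢z

  Pair : V → V → VSet G
  Pair a b u = u ≡ a ⊎ u ≡ b

  Walk-start : Walk G S u v → S u
  Walk-start (here Su)     = Su
  Walk-start (step Su _ _) = Su

  Walk-mono : Sub G S T → Walk G S u v → Walk G T u v
  Walk-mono S⊆T (here Su)       = here (S⊆T _ Su)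
  Walk-mono S⊆T (step Su uw wv) = step (S⊆T _ Su) uw (Walk-mono S⊆T wv)

  _++ʷ_ : Walk G S u w → Walk G S w v → Walk G S u v
  here _        ++ʷ q = q
  step Su uw wv ++ʷ q = step Su uw (wv ++ʷ q)

  Walk-reverse : Walk G S u v → Walk G S v u
  Walk-reverse (here Su)       = here Su
  Walk-reverse (step Su uw wv) = Walk-reverse wv ++ʷ step (Walk-start wv) (Edge-sym uw) (here Su)

  hub⇒ConnectedOn : (∀ {u} → S u → Walk G S u v) → ConnectedOn G S
  hub⇒ConnectedOn to-hub u w Su Sw = to-hub Su ++ʷ Walk-reverse (to-hub Sw)

  Walk-avoid : ∀ z → Walk G S u w → S z ⊎ Walk G (Delete G S z) u w
  Walk-avoid z (here {u} Su) with u ≟ᶠ z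
  ... | yes refl = inj₁ Su
  ... | no u≢z   = inj₂ (here (Su , u≢z))
  Walk-avoid z (step {u} Su uw wv) with u ≟ᶠ z
  ... | yes refl = inj₁ Su
  ... | no u≢z   = Sum.map₂ (step (Su , u≢z) uw) (Walk-avoid z wv)

  Nonseparable⇒walk-avoiding : Nonseparable G S → ∀ z → S u → S w → u ≢ z → w ≢ z →
                               Walk G (Delete G S z) u w
  Nonseparable⇒walk-avoiding (connected , deletion) z Su Sw u≢z w≢z
    with Walk-avoid z (connected _ _ Su Sw)
  ... | inj₁ Sz  = deletion z Sz _ _ (Su , u≢z) (Sw , w≢z)
  ... | inj₂ uw = uw

  Walk⇒last-neighbour : Walk G S u v → u ≢ v → ∃ λ p → S p × p ≢ v × Edge G v p
  Walk⇒last-neighbour (here _) u≢v = ⊥-elim (u≢v refl)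
  Walk⇒last-neighbour {v = v} (step {u} {w} Su uw wv) u≢v with w ≟ᶠ v
  ... | yes refl = u , Su , u≢v , Edge-sym uw
  ... | no w≢v   = Walk⇒last-neighbour wv w≢v

  Pair-walk : Edge G a b → Pair a b u → Pair a b w → S u → S w → Walk G S u w
  Pair-walk ab (inj₁ refl) (inj₁ refl) Su Sw = here Su
  Pair-walk ab (inj₁ refl) (inj₂ refl) Su Sw = step Su ab (here Sw)
  Pair-walk ab (inj₂ refl) (inj₁ refl) Su Sw = step Su (Edge-sym ab) (here Sw)
  Pair-walk ab (inj₂ refl) (inj₂ refl) Su Sw = here Su

  Pair-nonseparable : Edge G a b → Nonseparable G (Pair a b)
  Pair-nonseparable ab =
    (λ u w Pu Pw → Pair-walk ab Pu Pw Pu Pw) ,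
    (λ z _ u w Du Dw → Pair-walk ab (proj₁ Du) (proj₁ Dw) Du Dw)

  Nonseparable-add-vertex : Nonseparable G S → S a → S b → a ≢ b → Edge G y a → Edge G y b →
                            Nonseparable G (λ u → S u ⊎ u ≡ y)
  Nonseparable-add-vertex {S} {a} {b} {y} S-ns Sa Sb a≢b ya yb =
    hub⇒ConnectedOn to-a , deletion
    where
    S+y : VSet G
    S+y u = S u ⊎ u ≡ y

    to-a : S+y u → Walk G S+y u a
    to-a (inj₁ Su)   = Walk-mono (λ _ → inj₁) (proj₁ S-ns _ _ Su Sa)
    to-a (inj₂ refl) = step (inj₂ refl) ya (here (inj₁ Sa))

    avoiding-to : ∀ z → S c → c ≢ z → Edge G y c → S+y u → u ≢ z → Walk G (Delete G S+y z) u c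
    avoiding-to z Sc c≢z yc (inj₁ Su) u≢z =
      Walk-mono (Delete-mono (λ _ → inj₁)) (Nonseparable⇒walk-avoiding S-ns z Su Sc u≢z c≢z)
    avoiding-to z Sc c≢z yc (inj₂ refl) u≢z = step (inj₂ refl , u≢z) yc (here (inj₁ Sc , c≢z))

    deletion : ∀ z → S+y z → ConnectedOn G (Delete G S+y z)
    deletion z _ with a ≟ᶠ z
    ... | yes refl = hub⇒ConnectedOn (λ Du → avoiding-to z Sb (≢-sym a≢b) yb (proj₁ Du) (proj₂ Du))
    ... | no a≢z   = hub⇒ConnectedOn (λ Du → avoiding-to z Sa a≢z ya (proj₁ Du) (proj₂ Du))

  Nonseparable-∪ : Nonseparable G S → Nonseparable G T → S x → T x →
                   (∀ {u} → S u → u ≢ x → ∃ λ p → S p × T p × p ≢ x) →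
                   Nonseparable G (λ u → S u ⊎ T u)
  Nonseparable-∪ {S} {T} {x} S-ns T-ns Sx Tx shared = hub⇒ConnectedOn to-x , deletion
    where
    S∪T : VSet G
    S∪T u = S u ⊎ T u

    to-x : S∪T u → Walk G S∪T u x
    to-x (inj₁ Su) = Walk-mono (λ _ → inj₁) (proj₁ S-ns _ _ Su Sx)
    to-x (inj₂ Tu) = Walk-mono (λ _ → inj₂) (proj₁ T-ns _ _ Tu Tx)

    avoiding-to : ∀ z → S c → T c → c ≢ z → S∪T u → u ≢ z → Walk G (Delete G S∪T z) u c
    avoiding-to z Sc Tc c≢z (inj₁ Su) u≢z =
      Walk-mono (Delete-mono (λ _ → inj₁)) (Nonseparable⇒walk-avoiding S-ns z Su Sc u≢z c≢z)
    avoiding-to z Sc Tc c≢z (inj₂ Tu) u≢z =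
      Walk-mono (Delete-mono (λ _ → inj₂)) (Nonseparable⇒walk-avoiding T-ns z Tu Tc u≢z c≢z)

    via : ∀ z → S c → T c → c ≢ z → ConnectedOn G (Delete G S∪T z)
    via z Sc Tc c≢z = hub⇒ConnectedOn (λ Du → avoiding-to z Sc Tc c≢z (proj₁ Du) (proj₂ Du))

    -- When x itself is deleted, a second shared vertex serves as the hub;
    -- if there is none, S ⊆ {x} and T alone is involved.
    deletion : ∀ z → S∪T z → ConnectedOn G (Delete G S∪T z)
    deletion z _ with x ≟ᶠ z
    ... | no x≢z = via z Sx Tx x≢z
    deletion z _ | yes refl = connected
      where
      connected : ConnectedOn G (Delete G S∪T z)
      connected u w (inj₁ Su , u≢x) Dw with shared Su u≢x
      ... | p , Sp , Tp , p≢x = via z Sp Tp p≢x u w (inj₁ Su , u≢x) Dw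
      connected u w Du (inj₁ Sw , w≢x) with shared Sw w≢x
      ... | p , Sp , Tp , p≢x = via z Sp Tp p≢x u w Du (inj₁ Sw , w≢x)
      connected u w (inj₂ Tu , u≢x) (inj₂ Tw , w≢x) =
        Walk-mono (Delete-mono (λ _ → inj₂)) (Nonseparable⇒walk-avoiding T-ns z Tu Tw u≢x w≢x)

  only-neighbour⇒Block-≐Pair : Block G C → C v → Edge G v w →
                               (∀ {p} → C p → Edge G v p → p ≡ w) → SameSet G C (Pair v w)
  only-neighbour⇒Block-≐Pair {C} {v} {w} (C-ns , C-maximal) Cv vw only-w =
    C⊆vw , C-maximal (Pair v w) C⊆vw (Pair-nonseparable vw)
    where
    C⊆vw : Sub G C (Pair v w)
    C⊆vw u Cu with u ≟ᶠ v | u ≟ᶠ w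
    ... | yes u≡v | _       = inj₁ u≡v
    ... | no _    | yes u≡w = inj₂ u≡w
    ... | no u≢v  | no u≢w
      with Walk⇒last-neighbour (Nonseparable⇒walk-avoiding C-ns w Cu Cv u≢w (Edge⇒≢ vw)) u≢v
    ...   | p , (Cp , p≢w) , _ , vp = ⊥-elim (p≢w (only-w Cp vp))

  Block-has-neighbour : Block G C → C v → Edge G v u → ¬ (∀ {p} → C p → ¬ Edge G v p)
  Block-has-neighbour {C} {v} {u} C-block Cv vu none = none (proj₂ C≐vu u (inj₂ refl)) vu
    where
    C≐vu : SameSet G C (Pair v u)
    C≐vu = only-neighbour⇒Block-≐Pair C-block Cv vu (λ Cp vp → ⊥-elim (none Cp vp))

  pendant-block : Block G C → C v → Edge G v u → Decidable A → (∀ {p} → C p → A p → p ≡ v) →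
                  (∀ {p q} → Edge G v p → Edge G v q → ¬ A p → ¬ A q → p ≡ q) →
                  ∃ λ w → Edge G v w × ¬ A w × SameSet G C (Pair v w)
  pendant-block {C} {v} {A = A} C-block Cv vu A? C∩A⊆v unique =
    search (any? (λ w → Edge? v w ×-dec ¬? (A? w)))
    where
    outside : C p → Edge G v p → ¬ A p
    outside Cp vp Ap = Edge⇒≢ vp (≡.sym (C∩A⊆v Cp Ap))

    search : Dec (∃ λ w → Edge G v w × ¬ A w) →
             ∃ λ w → Edge G v w × ¬ A w × SameSet G C (Pair v w)
    search (yes (w , vw , w∉A)) =
      w , vw , w∉A ,
      only-neighbour⇒Block-≐Pair C-block Cv vw (λ Cp vp → unique vp vw (outside Cp vp) w∉A)
    search (no none) = ⊥-elim (Block-has-neighbour C-block Cv vu λ Cp vp →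
      outside Cp vp (decidable-stable (A? _) (λ p∉A → none (_ , vp , p∉A))))

  neighbours⊆⇒Block-≐ : Block G C → Block G D → C x → D x →
                        (∀ {p} → C p → Edge G x p → D p) → SameSet G C D
  neighbours⊆⇒Block-≐ {C} {D} {x} (C-ns , C-maximal) (D-ns , D-maximal) Cx Dx neighbours-in-D =
    (λ u Cu → D-maximal C∪D (λ _ → inj₂) C∪D-ns u (inj₁ Cu)) ,
    (λ u Du → C-maximal C∪D (λ _ → inj₁) C∪D-ns u (inj₂ Du))
    where
    C∪D : VSet G
    C∪D u = C u ⊎ D u

    shared : C u → u ≢ x → ∃ λ p → C p × D p × p ≢ x
    shared Cu u≢x with Walk⇒last-neighbour (proj₁ C-ns _ _ Cu Cx) u≢x
    ... | p , Cp , p≢x , xp = p , Cp , neighbours-in-D Cp xp , p≢x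

    C∪D-ns : Nonseparable G C∪D
    C∪D-ns = Nonseparable-∪ C-ns D-ns Cx Dx shared

  Pair-InducedIso-M2 : Edge G a b → SameSet G C (Pair a b) → InducedIso G C M2
  Pair-InducedIso-M2 {a} {b} {C} ab (C⊆ab , ab⊆C) =
    embed , (λ {i} {j} → lookup-injective ((Edge⇒≢ ab ∷ []) ∷ [] ∷ []) i j) ,
    into , onto , adjacency
    where
    embed : Fin 2 → V
    embed = lookup (a ∷ b ∷ [])

    into : ∀ i → C (embed i)
    into zero       = ab⊆C a (inj₁ refl)
    into (suc zero) = ab⊆C b (inj₂ refl)

    onto : ∀ u → C u → ∃ λ i → embed i ≡ u
    onto u Cu with C⊆ab u Cu
    ... | inj₁ refl = zero , refl
    ... | inj₂ refl = suc zero , refl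

    adjacency : ∀ i j → adj M2 i j ≡ adj G (embed i) (embed j)
    adjacency zero       zero       = ≡.sym (irrefl G a)
    adjacency zero       (suc zero) = ≡.sym ab
    adjacency (suc zero) zero       = ≡.sym (Edge-sym ab)
    adjacency (suc zero) (suc zero) = ≡.sym (irrefl G b)

  double-star : Unique (a ∷ b ∷ c ∷ d ∷ e ∷ g ∷ []) →
                Edge G a b → Edge G a c → Edge G a d → Edge G b e → Edge G b g →
                ContainsSubgraph G S22
  double-star {a} {b} {c} {d} {e} {g} distinct ab ac ad be bg =
    embed , (λ {i} {j} → lookup-injective distinct i j) , edges
    where
    embed : Fin 6 → V
    embed = lookup (a ∷ b ∷ c ∷ d ∷ e ∷ g ∷ [])

    edges : ∀ i j → Edge S22 i j → Edge G (embed i) (embed j)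
    edges zero zero ()
    edges zero (suc zero) _ = ab
    edges zero (suc (suc zero)) _ = ac
    edges zero (suc (suc (suc zero))) _ = ad
    edges zero (suc (suc (suc (suc _)))) ()
    edges (suc zero) zero _ = Edge-sym ab
    edges (suc zero) (suc zero) ()
    edges (suc zero) (suc (suc zero)) ()
    edges (suc zero) (suc (suc (suc zero))) ()
    edges (suc zero) (suc (suc (suc (suc zero)))) _ = be
    edges (suc zero) (suc (suc (suc (suc (suc zero))))) _ = bg
    edges (suc (suc zero)) zero _ = Edge-sym ac
    edges (suc (suc zero)) (suc _) ()
    edges (suc (suc (suc zero))) zero _ = Edge-sym ad
    edges (suc (suc (suc zero))) (suc _) ()
    edges (suc (suc (suc (suc zero)))) zero ()
    edges (suc (suc (suc (suc zero)))) (suc zero) _ = Edge-sym be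
    edges (suc (suc (suc (suc zero)))) (suc (suc _)) ()
    edges (suc (suc (suc (suc (suc zero))))) zero ()
    edges (suc (suc (suc (suc (suc zero))))) (suc zero) _ = Edge-sym bg
    edges (suc (suc (suc (suc (suc zero))))) (suc (suc _)) ()

  S22-free⇒unique-outside-neighbour :
    ¬ ContainsSubgraph G S22 → Edge G b c → Edge G c k → Edge G c l → k ≢ l → b ≢ k → b ≢ l →
    A c → A k → A l → Edge G b p → Edge G b q → ¬ A p → ¬ A q → p ≡ q
  S22-free⇒unique-outside-neighbour {b} {c} {k} {l} {A} {p} {q}
    S22-free bc ck cl k≢l b≢k b≢l Ac Ak Al bp bq p∉A q∉A =
    decidable-stable (p ≟ᶠ q) (λ p≢q → S22-free (double-star (distinct p≢q) bc bp bq ck cl))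
    where
    distinct : p ≢ q → Unique (b ∷ c ∷ p ∷ q ∷ k ∷ l ∷ [])
    distinct p≢q =
      (Edge⇒≢ bc ∷ Edge⇒≢ bp ∷ Edge⇒≢ bq ∷ b≢k ∷ b≢l ∷ []) ∷
      (∈∉⇒≢ Ac p∉A ∷ ∈∉⇒≢ Ac q∉A ∷ Edge⇒≢ ck ∷ Edge⇒≢ cl ∷ []) ∷
      (p≢q ∷ ≢-sym (∈∉⇒≢ Ak p∉A) ∷ ≢-sym (∈∉⇒≢ Al p∉A) ∷ []) ∷
      (≢-sym (∈∉⇒≢ Ak q∉A) ∷ ≢-sym (∈∉⇒≢ Al q∉A) ∷ []) ∷
      (k≢l ∷ []) ∷ [] ∷ []

module AdjacentToM4
  (G : Graph) (S22-free : ¬ ContainsSubgraph G S22)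
  {B A : VSet G} (B-block : Block G B) (A-block : Block G A)
  {f : Fin 4 → Fin (n G)} (f-injective : Injective _≡_ _≡_ f) (f-into : ∀ i → A (f i))
  (f-onto : ∀ v → A v → ∃ λ i → f i ≡ v) (f-adj : ∀ i j → adj M4 i j ≡ adj G (f i) (f j))
  (i₀ : Fin 4) (B-x : B (f i₀)) (B∩A⊆x : ∀ w → B w → A w → w ≡ f i₀)
  where

  open Properties G

  private
    V : Set
    V = Fin (n G)

    variable
      C D : VSet G
      p q : V

  x : V
  x = f i₀

  A-x : A x
  A-x = f-into i₀

  A? : Decidable A
  A? u with any? (λ i → f i ≟ᶠ u)
  ... | yes (i , fi≡u) = yes (subst A fi≡u (f-into i))
  ... | no u∉f         = no (λ Au → u∉f (f-onto u Au))

  f-edge : ∀ {i j} → Edge M4 i j → Edge G (f i) (f j)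
  f-edge {i} {j} ij = trans (≡.sym (f-adj i j)) ij

  f-≢ : ∀ {i j} → i ≢ j → f i ≢ f j
  f-≢ i≢j fi≡fj = i≢j (f-injective fi≡fj)

  x-outside-neighbour-unique : Edge G x p → Edge G x q → ¬ A p → ¬ A q → p ≡ q
  x-outside-neighbour-unique =
    let j , i₀j , k , l , k≢l , i₀≢k , i₀≢l , jk , jl = M4-degree-3-neighbour i₀ in
    S22-free⇒unique-outside-neighbour S22-free (f-edge i₀j) (f-edge jk) (f-edge jl)
      (f-≢ k≢l) (f-≢ i₀≢k) (f-≢ i₀≢l) (f-into j) (f-into k) (f-into l)

  B-pendant : ∃ λ y → Edge G x y × ¬ A y × SameSet G B (Pair x y)
  B-pendant =
    let k , _ , _ , i₀k , _ = M4-minimum-degree-2 i₀ in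
    pendant-block B-block B-x (f-edge i₀k) A? (λ {p} → B∩A⊆x p) x-outside-neighbour-unique

  y : V
  y = proj₁ B-pendant

  x-y : Edge G x y
  x-y = proj₁ (proj₂ B-pendant)

  y∉A : ¬ A y
  y∉A = proj₁ (proj₂ (proj₂ B-pendant))

  B≐xy : SameSet G B (Pair x y)
  B≐xy = proj₂ (proj₂ (proj₂ B-pendant))

  y≢f : ∀ i → y ≢ f i
  y≢f i = ≢-sym (∈∉⇒≢ {A = A} (f-into i) y∉A)

  -- Otherwise y would have two neighbours x and p in A, and A ∪ {y} would still be nonseparable.
  y-neighbour∉A : Edge G y p → p ≢ x → ¬ A p
  y-neighbour∉A y-p p≢x Ap = y∉A (proj₂ A-block _ (λ _ → inj₁) A+y-ns y (inj₂ refl))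
    where
    A+y-ns : Nonseparable G (λ u → A u ⊎ u ≡ y)
    A+y-ns = Nonseparable-add-vertex (proj₁ A-block) A-x Ap (≢-sym p≢x) (Edge-sym x-y) y-p

  y-other-neighbour-unique : Edge G y p → Edge G y q → p ≢ x → q ≢ x → p ≡ q
  y-other-neighbour-unique y-p y-q p≢x q≢x =
    let k , l , k≢l , i₀k , i₀l = M4-minimum-degree-2 i₀ in
    S22-free⇒unique-outside-neighbour S22-free (Edge-sym x-y) (f-edge i₀k) (f-edge i₀l)
      (f-≢ k≢l) (y≢f k) (y≢f l) A-x (f-into k) (f-into l)
      y-p y-q (y-neighbour∉A y-p p≢x) (y-neighbour∉A y-q q≢x)

  PendantAtY : VSet G → Set
  PendantAtY C = ∃ λ z → Edge G y z × z ≢ x × SameSet G C (Pair y z)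

  PendantAtY-unique : PendantAtY C → PendantAtY D → SameSet G C D
  PendantAtY-unique (z , y-z , z≢x , C≐yz) (z′ , y-z′ , z′≢x , D≐yz′)
    rewrite y-other-neighbour-unique y-z y-z′ z≢x z′≢x = SameSet-trans C≐yz (SameSet-sym D≐yz′)

  block-at-x : Block G C → C x → (∀ w → B w → C w → w ≡ x) → SameSet G C A
  block-at-x {C} C-block C-x B∩C⊆x = neighbours⊆⇒Block-≐ C-block A-block C-x A-x neighbour-in-A
    where
    neighbour-in-A : C p → Edge G x p → A p
    neighbour-in-A {p} C-p x-p = decidable-stable (A? p) λ p∉A →
      Edge⇒≢ x-y (≡.sym (B∩C⊆x y (proj₂ B≐xy y (inj₂ refl))
                          (subst C (x-outside-neighbour-unique x-p x-y p∉A y∉A) C-p)))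

  block-at-y : Block G C → C y → (∀ w → B w → C w → w ≡ y) → PendantAtY C
  block-at-y {C} C-block C-y B∩C⊆y =
    pendant-block C-block C-y (Edge-sym x-y) (_≟ᶠ x) C∩x⊆y y-other-neighbour-unique
    where
    C∩x⊆y : C p → p ≡ x → p ≡ y
    C∩x⊆y C-p refl = B∩C⊆y x B-x C-p

  adjacent-block : Block G C → AdjacentBlocks G B C → SameSet G C A ⊎ PendantAtY C
  adjacent-block C-block (s , (B-s , C-s) , B∩C⊆s) with proj₁ B≐xy s B-s
  ... | inj₁ refl = inj₁ (block-at-x C-block C-s B∩C⊆s)
  ... | inj₂ refl = inj₂ (block-at-y C-block C-s B∩C⊆s)

  B≅M2 : InducedIso G B M2
  B≅M2 = Pair-InducedIso-M2 x-y B≐xy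

  at-most-two-adjacent-blocks : ∀ C₁ C₂ C₃ → Block G C₁ → Block G C₂ → Block G C₃ →
    AdjacentBlocks G B C₁ → AdjacentBlocks G B C₂ → AdjacentBlocks G B C₃ →
    SameSet G C₁ C₂ ⊎ SameSet G C₁ C₃ ⊎ SameSet G C₂ C₃
  at-most-two-adjacent-blocks C₁ C₂ C₃ b₁ b₂ b₃ B-C₁ B-C₂ B-C₃ =
    pigeonhole (SameSet G) (λ C≐A D≐A → SameSet-trans C≐A (SameSet-sym D≐A)) PendantAtY-unique
      (adjacent-block b₁ B-C₁) (adjacent-block b₂ B-C₂) (adjacent-block b₃ B-C₃)

  other-adjacent-block≅M2 : ∀ C → Block G C → AdjacentBlocks G B C → ¬ SameSet G C A →
                            InducedIso G C M2
  other-adjacent-block≅M2 C C-block B-C C≉A with adjacent-block C-block B-C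
  ... | inj₁ C≐A                   = ⊥-elim (C≉A C≐A)
  ... | inj₂ (z , y-z , _ , C≐yz) = Pair-InducedIso-M2 y-z C≐yz

lemma7 : (G : Graph) → ¬ ContainsSubgraph G S22 → Connected G → Outerplanar G → 6 ≤ n G →
    (B A : VSet G) → Block G B → Block G A → AdjacentBlocks G B A → InducedIso G A M4 →
    InducedIso G B M2
    × (∀ C₁ C₂ C₃ → Block G C₁ → Block G C₂ → Block G C₃ →
         AdjacentBlocks G B C₁ → AdjacentBlocks G B C₂ → AdjacentBlocks G B C₃ →
         SameSet G C₁ C₂ ⊎ SameSet G C₁ C₃ ⊎ SameSet G C₂ C₃)
    × (∀ C → Block G C → AdjacentBlocks G B C → ¬ SameSet G C A → InducedIso G C M2)
lemma7 G S22-free _ _ _ B A B-block A-block (x , (B-x , A-x) , B∩A⊆x)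
  (f , f-injective , f-into , f-onto , f-adj)
  with f-onto x A-x
... | i₀ , refl = B≅M2 , at-most-two-adjacent-blocks , other-adjacent-block≅M2
  where
  open AdjacentToM4 G S22-free B-block A-block f-injective f-into f-onto f-adj i₀ B-x B∩A⊆x
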